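{- Let $G$ be a graph and let $T\subseteq V(G)$ be a set of vertices that are pairwise false twins, none of which are true twins and none of which is simplicial. Then every minimum-size geodetic set of $G$ contains at most four vertices of $T$.
   Context: Graphs are finite, simple, undirected. $N(u)$ is the open neighborhood and $N[u]=N(u)\cup\{u\}$. Vertices $u,v$ are false twins if $N(u)=N(v)$ and true twins if $N[u]=N[v]$. A vertex is simplicial if its neighborhood is a clique. A geodetic set of $G$ is a set $S\subseteq V(G)$ such that every vertex of $G$ lies on some shortest path between two vertices $s_1,s_2\in S$. -}

module Defs where

open import Data.Nat using (ℕ; zero; suc; _≤_)
open import Data.Fin using (Fin)
open import Data.Fin.Subset using (Subset; _∈_; ∣_∣; _∩_)
open import Data.Product using (_×_; Σ; ∃; ∃-syntax; _,_)
open import Data.Sum using (_⊎_)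
open import Relation.Nullary using (¬_; Dec)
open import Relation.Binary.PropositionalEquality using (_≡_)
open import Function.Bundles using (_⇔_)

record Graph (n : ℕ) : Set₁ where
  field
    Adj    : Fin n → Fin n → Set
    adj?   : ∀ u v → Dec (Adj u v)
    sym    : ∀ {u v} → Adj u v → Adj v u
    irrefl : ∀ {u} → ¬ Adj u u

module _ {n : ℕ} (G : Graph n) where
  open Graph G

  InN : Fin n → Fin n → Set
  InN x u = Adj u x

  InN[] : Fin n → Fin n → Set
  InN[] x u = (x ≡ u) ⊎ Adj u x

  FalseTwins : Fin n → Fin n → Set
  FalseTwins u v = ∀ x → InN x u ⇔ InN x v

  TrueTwins : Fin n → Fin n → Set
  TrueTwins u v = ∀ x → InN[] x u ⇔ InN[] x v

  Simplicial : Fin n → Set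
  Simplicial u = ∀ x y → InN x u → InN y u → ¬ (x ≡ y) → Adj x y

  data Walk : Fin n → Fin n → Set where
    [] : ∀ {u} → Walk u u
    _∷_ : ∀ {u w v} → Adj u w → Walk w v → Walk u v

  walkLength : ∀ {u v} → Walk u v → ℕ
  walkLength [] = zero
  walkLength (_ ∷ p) = suc (walkLength p)

  OnWalk : ∀ {u v} → Fin n → Walk u v → Set
  OnWalk {u} x [] = x ≡ u
  OnWalk {u} x (_ ∷ p) = (x ≡ u) ⊎ OnWalk x p

  IsShortest : ∀ {u v} → Walk u v → Set
  IsShortest {u} {v} p = ∀ (q : Walk u v) → walkLength p ≤ walkLength q

  IsGeodetic : Subset n → Set
  IsGeodetic S = ∀ x → ∃[ s₁ ] ∃[ s₂ ] (s₁ ∈ S × s₂ ∈ S ×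
                   Σ (Walk s₁ s₂) λ p → IsShortest p × OnWalk x p)

  IsMinimumGeodetic : Subset n → Set
  IsMinimumGeodetic S = IsGeodetic S × (∀ S′ → IsGeodetic S′ → ∣ S ∣ ≤ ∣ S′ ∣)

-- Suppose S is geodetic and contains two distinct members t₁, t₂ of T. Since
-- all of T have one and the same neighbourhood, a shortest path with an end in
-- T may trade that end for t₁ or t₂ (whichever differs from its other end),
-- and every vertex of T is the middle of a geodesic x – z – y, where x and y
-- are non-adjacent neighbours of the non-simplicial t₁. Hence
-- (S ∖ T) ∪ {t₁, t₂, x, y} is geodetic as well, and minimality of S gives
-- |S ∩ T| ≤ 4.
module Submission where

open import Defs
open import Data.Nat using (ℕ; suc; _+_; _≤_; _<_; z≤n; s≤s; _≤?_)
open import Data.Nat.Properties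
  using (≤-trans; ≤-reflexive; n≤1+n; +-suc; +-identityʳ; +-monoʳ-≤; +-cancelˡ-≤; ≰⇒>; module ≤-Reasoning)
open import Data.List using (List; []; _∷_; foldr; length)
open import Data.List.Membership.Propositional using () renaming (_∈_ to _∈ˡ_)
import Data.List.Relation.Unary.Any as Any
open import Data.Vec using ([]; _∷_; here; there)
open import Data.Fin using (Fin; zero; suc; _≟_)
open import Data.Fin.Properties using (any?; suc-injective)
open import Data.Fin.Subset using (Subset; _∈_; _⊆_; ∣_∣; _∩_; _∪_; _─_; ⁅_⁆; ⊥; Nonempty; inside; outside)
open import Data.Fin.Subset.Properties
  using (_∈?_; x∈⁅x⁆; ∣⁅x⁆∣≡1; ∣⊥∣≡0; p⊆p∪q; q⊆p∪q; x∈p∩q⁻; x∈p∧x∉q⇒x∈p─q)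
open import Data.Product using (Σ; ∃-syntax; ∃₂; _×_; _,_)
open import Data.Sum using (_⊎_; inj₁; inj₂)
open import Function using (_∘_)
open import Function.Bundles using (Equivalence)
open import Function.Properties.Equivalence using () renaming (refl to ⇔-refl)
open import Relation.Nullary using (¬_; yes; no; contradiction)
open import Relation.Nullary.Decidable using (_×-dec_; ¬?; decidable-stable)
open import Relation.Binary.PropositionalEquality using (_≡_; _≢_; refl; sym; trans; cong)

∣p∪q∣≤∣p∣+∣q∣ : ∀ {m} (p q : Subset m) → ∣ p ∪ q ∣ ≤ ∣ p ∣ + ∣ q ∣
∣p∪q∣≤∣p∣+∣q∣ []            []            = z≤n
∣p∪q∣≤∣p∣+∣q∣ (outside ∷ p) (outside ∷ q) = ∣p∪q∣≤∣p∣+∣q∣ p q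
∣p∪q∣≤∣p∣+∣q∣ (outside ∷ p) (inside  ∷ q) =
  ≤-trans (s≤s (∣p∪q∣≤∣p∣+∣q∣ p q)) (≤-reflexive (sym (+-suc ∣ p ∣ ∣ q ∣)))
∣p∪q∣≤∣p∣+∣q∣ (inside  ∷ p) (outside ∷ q) = s≤s (∣p∪q∣≤∣p∣+∣q∣ p q)
∣p∪q∣≤∣p∣+∣q∣ (inside  ∷ p) (inside  ∷ q) =
  s≤s (≤-trans (∣p∪q∣≤∣p∣+∣q∣ p q) (+-monoʳ-≤ ∣ p ∣ (n≤1+n ∣ q ∣)))

∣p∣≡∣p─q∣+∣p∩q∣ : ∀ {m} (p q : Subset m) → ∣ p ∣ ≡ ∣ p ─ q ∣ + ∣ p ∩ q ∣
∣p∣≡∣p─q∣+∣p∩q∣ []            []            = refl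
∣p∣≡∣p─q∣+∣p∩q∣ (outside ∷ p) (outside ∷ q) = ∣p∣≡∣p─q∣+∣p∩q∣ p q
∣p∣≡∣p─q∣+∣p∩q∣ (outside ∷ p) (inside  ∷ q) = ∣p∣≡∣p─q∣+∣p∩q∣ p q
∣p∣≡∣p─q∣+∣p∩q∣ (inside  ∷ p) (outside ∷ q) = cong suc (∣p∣≡∣p─q∣+∣p∩q∣ p q)
∣p∣≡∣p─q∣+∣p∩q∣ (inside  ∷ p) (inside  ∷ q) =
  trans (cong suc (∣p∣≡∣p─q∣+∣p∩q∣ p q)) (sym (+-suc ∣ p ─ q ∣ ∣ p ∩ q ∣))

0<∣p∣⇒Nonempty : ∀ {m} (p : Subset m) → 0 < ∣ p ∣ → Nonempty p
0<∣p∣⇒Nonempty (inside  ∷ p) _ = zero , here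
0<∣p∣⇒Nonempty (outside ∷ p) 0<∣p∣ with x , x∈p ← 0<∣p∣⇒Nonempty p 0<∣p∣ = suc x , there x∈p

1<∣p∣⇒∃₂≢ : ∀ {m} (p : Subset m) → 1 < ∣ p ∣ → ∃₂ λ x y → x ∈ p × y ∈ p × x ≢ y
1<∣p∣⇒∃₂≢ (inside ∷ p) (s≤s 0<∣p∣) with y , y∈p ← 0<∣p∣⇒Nonempty p 0<∣p∣ =
  zero , suc y , here , there y∈p , λ ()
1<∣p∣⇒∃₂≢ (outside ∷ p) 1<∣p∣ with x , y , x∈p , y∈p , x≢y ← 1<∣p∣⇒∃₂≢ p 1<∣p∣ =
  suc x , suc y , there x∈p , there y∈p , x≢y ∘ suc-injective

fromList : ∀ {m} → List (Fin m) → Subset m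
fromList = foldr (λ x p → ⁅ x ⁆ ∪ p) ⊥

∣fromList∣≤length : ∀ {m} (xs : List (Fin m)) → ∣ fromList xs ∣ ≤ length xs
∣fromList∣≤length {m} []       = ≤-reflexive (∣⊥∣≡0 m)
∣fromList∣≤length      (x ∷ xs) = begin
  ∣ ⁅ x ⁆ ∪ fromList xs ∣         ≤⟨ ∣p∪q∣≤∣p∣+∣q∣ ⁅ x ⁆ (fromList xs) ⟩
  ∣ ⁅ x ⁆ ∣ + ∣ fromList xs ∣     ≡⟨ cong (_+ ∣ fromList xs ∣) (∣⁅x⁆∣≡1 x) ⟩
  suc ∣ fromList xs ∣             ≤⟨ s≤s (∣fromList∣≤length xs) ⟩
  suc (length xs)                 ∎
  where open ≤-Reasoning

∈fromList : ∀ {m} {x : Fin m} {xs} → x ∈ˡ xs → x ∈ fromList xs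
∈fromList {x = x} {xs = _ ∷ xs} (Any.here refl) = p⊆p∪q (fromList xs) (x∈⁅x⁆ x)
∈fromList         {xs = y ∷ xs} (Any.there x∈xs) = q⊆p∪q ⁅ y ⁆ (fromList xs) (∈fromList x∈xs)

module _ {n : ℕ} (G : Graph n) where
  open Graph G renaming (sym to adj-sym)

  OnGeodesic : Fin n → Fin n → Fin n → Set
  OnGeodesic z u v = Σ (Walk G u v) λ p → IsShortest G p × OnWalk G z p

  PairwiseFalseTwins : Subset n → Set
  PairwiseFalseTwins T = ∀ u v → u ∈ T → v ∈ T → ¬ (u ≡ v) → FalseTwins G u v

  falseTwins : ∀ {T u v} → PairwiseFalseTwins T → u ∈ T → v ∈ T → FalseTwins G u v
  falseTwins {u = u} {v} twins u∈T v∈T with u ≟ v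
  ... | yes refl = λ _ → ⇔-refl
  ... | no u≢v   = twins u v u∈T v∈T u≢v

  ¬Simplicial⇒nonAdjacentNeighbours : ∀ u → ¬ Simplicial G u →
    ∃₂ λ x y → Adj u x × Adj u y × x ≢ y × ¬ Adj x y
  ¬Simplicial⇒nonAdjacentNeighbours u ¬simplicial
    with any? (λ x → any? (λ y → adj? u x ×-dec adj? u y ×-dec ¬? (x ≟ y) ×-dec ¬? (adj? x y)))
  ... | yes (x , y , witness) = x , y , witness
  ... | no ¬witness = contradiction simplicial ¬simplicial
    where
    simplicial : Simplicial G u
    simplicial x y ux uy x≢y =
      decidable-stable (adj? x y) λ ¬xy → ¬witness (x , y , ux , uy , x≢y , ¬xy)

  commonNeighbour-onGeodesic : ∀ {x y z} → Adj z x → Adj z y → x ≢ y → ¬ Adj x y →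
    OnGeodesic z x y
  commonNeighbour-onGeodesic zx zy x≢y ¬xy = adj-sym zx ∷ zy ∷ [] , shortest , inj₂ (inj₁ refl)
    where
    shortest : IsShortest G (adj-sym zx ∷ zy ∷ [])
    shortest []          = contradiction refl x≢y
    shortest (xy ∷ [])   = contradiction xy ¬xy
    shortest (_ ∷ _ ∷ _) = s≤s (s≤s z≤n)

  reverseOnto : ∀ {u v w} → Walk G u v → Walk G u w → Walk G v w
  reverseOnto []      acc = acc
  reverseOnto (e ∷ p) acc = reverseOnto p (adj-sym e ∷ acc)

  reverse : ∀ {u v} → Walk G u v → Walk G v u
  reverse p = reverseOnto p []

  length-reverseOnto : ∀ {u v w} (p : Walk G u v) (acc : Walk G u w) →
    walkLength G (reverseOnto p acc) ≡ walkLength G p + walkLength G acc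
  length-reverseOnto []      acc = refl
  length-reverseOnto (e ∷ p) acc =
    trans (length-reverseOnto p (adj-sym e ∷ acc)) (+-suc (walkLength G p) (walkLength G acc))

  length-reverse : ∀ {u v} (p : Walk G u v) → walkLength G (reverse p) ≡ walkLength G p
  length-reverse p = trans (length-reverseOnto p []) (+-identityʳ (walkLength G p))

  onWalk-start : ∀ {u v} (p : Walk G u v) → OnWalk G u p
  onWalk-start []      = refl
  onWalk-start (_ ∷ _) = inj₁ refl

  onWalk-reverseOnto : ∀ {u v w z} (p : Walk G u v) (acc : Walk G u w) →
    OnWalk G z p ⊎ OnWalk G z acc → OnWalk G z (reverseOnto p acc)
  onWalk-reverseOnto []      acc (inj₁ refl)          = onWalk-start acc
  onWalk-reverseOnto []      acc (inj₂ z∈acc)         = z∈acc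
  onWalk-reverseOnto (e ∷ p) acc (inj₁ (inj₁ refl))   = onWalk-reverseOnto p (adj-sym e ∷ acc) (inj₂ (inj₂ (onWalk-start acc)))
  onWalk-reverseOnto (e ∷ p) acc (inj₁ (inj₂ z∈p))    = onWalk-reverseOnto p (adj-sym e ∷ acc) (inj₁ z∈p)
  onWalk-reverseOnto (e ∷ p) acc (inj₂ z∈acc)         = onWalk-reverseOnto p (adj-sym e ∷ acc) (inj₂ (inj₂ z∈acc))

  onGeodesic-sym : ∀ {u v z} → OnGeodesic z u v → OnGeodesic z v u
  onGeodesic-sym (p , p-shortest , z∈p) = reverse p , shortest , onWalk-reverseOnto p [] (inj₁ z∈p)
    where
    open ≤-Reasoning
    shortest : IsShortest G (reverse p)
    shortest q = begin
      walkLength G (reverse p) ≡⟨ length-reverse p ⟩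
      walkLength G p           ≤⟨ p-shortest (reverse q) ⟩
      walkLength G (reverse q) ≡⟨ length-reverse q ⟩
      walkLength G q           ∎

  onGeodesic-replaceStart : ∀ {u t v z} → FalseTwins G u t → t ≢ v → z ≢ u →
    OnGeodesic z u v → OnGeodesic z t v
  onGeodesic-replaceStart twins t≢v z≢u ([]    , _ , z≡u)      = contradiction z≡u z≢u
  onGeodesic-replaceStart twins t≢v z≢u (_ ∷ _ , _ , inj₁ z≡u) = contradiction z≡u z≢u
  onGeodesic-replaceStart twins t≢v z≢u (e ∷ p , p-shortest , inj₂ z∈p) =
    Equivalence.to (twins _) e ∷ p , shortest , inj₂ z∈p
    where
    shortest : IsShortest G (Equivalence.to (twins _) e ∷ p)
    shortest []      = contradiction refl t≢v
    shortest (f ∷ q) = p-shortest (Equivalence.from (twins _) f ∷ q)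

  geodetic-exchange : ∀ {T S S′ t₁ t₂} → PairwiseFalseTwins T →
    t₁ ∈ T → t₂ ∈ T → t₁ ≢ t₂ → t₁ ∈ S′ → t₂ ∈ S′ → S ─ T ⊆ S′ →
    (∀ z → z ∈ T → ∃₂ λ s₁ s₂ → s₁ ∈ S′ × s₂ ∈ S′ × OnGeodesic z s₁ s₂) →
    IsGeodetic G S → IsGeodetic G S′
  geodetic-exchange {T} {S} {S′} {t₁} {t₂} twins t₁∈T t₂∈T t₁≢t₂ t₁∈S′ t₂∈S′ S─T⊆S′ T-covered geodetic z
    with z ∈? T
  ... | yes z∈T = T-covered z z∈T
  ... | no  z∉T =
    let s₁ , s₂ , s₁∈S , s₂∈S , z-on = geodetic z
        a , a∈S′ , z-on′ = replaceStart s₁∈S z-on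
        b , b∈S′ , z-on″ = replaceStart s₂∈S (onGeodesic-sym z-on′)
    in  a , b , a∈S′ , b∈S′ , onGeodesic-sym z-on″
    where
    memberAvoiding : ∀ v → ∃[ t ] (t ∈ T × t ∈ S′ × t ≢ v)
    memberAvoiding v with t₁ ≟ v
    ... | no  t₁≢v = t₁ , t₁∈T , t₁∈S′ , t₁≢v
    ... | yes refl = t₂ , t₂∈T , t₂∈S′ , t₁≢t₂ ∘ sym

    replaceStart : ∀ {s v} → s ∈ S → OnGeodesic z s v → ∃[ a ] (a ∈ S′ × OnGeodesic z a v)
    replaceStart {s} {v} s∈S z-on with s ∈? T
    ... | no  s∉T = s , S─T⊆S′ (x∈p∧x∉q⇒x∈p─q s∈S s∉T) , z-on
    ... | yes s∈T with t , t∈T , t∈S′ , t≢v ← memberAvoiding v =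
      t , t∈S′ , onGeodesic-replaceStart (falseTwins twins s∈T t∈T) t≢v z≢s z-on
      where
      z≢s : z ≢ s
      z≢s refl = z∉T s∈T

  replaceTwinsByFour : ∀ {T S} → PairwiseFalseTwins T → (∀ t → t ∈ T → ¬ Simplicial G t) →
    1 < ∣ S ∩ T ∣ → IsGeodetic G S → ∃[ S′ ] (IsGeodetic G S′ × ∣ S′ ∣ ≤ ∣ S ─ T ∣ + 4)
  replaceTwinsByFour {T} {S} twins ¬simplicial 1<∣S∩T∣ geodetic
    with t₁ , t₂ , t₁∈S∩T , t₂∈S∩T , t₁≢t₂ ← 1<∣p∣⇒∃₂≢ (S ∩ T) 1<∣S∩T∣
    with _ , t₁∈T ← x∈p∩q⁻ S T t₁∈S∩T
    with _ , t₂∈T ← x∈p∩q⁻ S T t₂∈S∩T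
    with x , y , t₁x , t₁y , x≢y , ¬xy ← ¬Simplicial⇒nonAdjacentNeighbours t₁ (¬simplicial t₁ t₁∈T)
    = S′ , S′-geodetic , ∣S′∣≤∣S─T∣+4
    where
    new : List (Fin n)
    new = t₁ ∷ t₂ ∷ x ∷ y ∷ []

    S′ : Subset n
    S′ = (S ─ T) ∪ fromList new

    new⊆S′ : ∀ {v} → v ∈ˡ new → v ∈ S′
    new⊆S′ = q⊆p∪q (S ─ T) (fromList new) ∘ ∈fromList

    T-covered : ∀ z → z ∈ T → ∃₂ λ s₁ s₂ → s₁ ∈ S′ × s₂ ∈ S′ × OnGeodesic z s₁ s₂
    T-covered z z∈T = x , y , new⊆S′ (Any.there (Any.there (Any.here refl))) ,
      new⊆S′ (Any.there (Any.there (Any.there (Any.here refl)))) ,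
      commonNeighbour-onGeodesic (Equivalence.to (t₁≈z x) t₁x) (Equivalence.to (t₁≈z y) t₁y) x≢y ¬xy
      where
      t₁≈z : FalseTwins G t₁ z
      t₁≈z = falseTwins twins t₁∈T z∈T

    S′-geodetic : IsGeodetic G S′
    S′-geodetic = geodetic-exchange twins t₁∈T t₂∈T t₁≢t₂ (new⊆S′ (Any.here refl))
      (new⊆S′ (Any.there (Any.here refl))) (p⊆p∪q (fromList new)) T-covered geodetic

    ∣S′∣≤∣S─T∣+4 : ∣ S′ ∣ ≤ ∣ S ─ T ∣ + 4
    ∣S′∣≤∣S─T∣+4 = ≤-trans (∣p∪q∣≤∣p∣+∣q∣ (S ─ T) (fromList new))
                           (+-monoʳ-≤ ∣ S ─ T ∣ (∣fromList∣≤length new))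

lemma10 : ∀ {n : ℕ} (G : Graph n) (T : Subset n) →
    (∀ u v → u ∈ T → v ∈ T → ¬ (u ≡ v) → FalseTwins G u v) →
    (∀ u v → u ∈ T → v ∈ T → ¬ (u ≡ v) → ¬ TrueTwins G u v) →
    (∀ t → t ∈ T → ¬ Simplicial G t) →
    ∀ (S : Subset n) → IsMinimumGeodetic G S → ∣ S ∩ T ∣ ≤ 4
lemma10 G T twins _ ¬simplicial S (geodetic , minimum) with ∣ S ∩ T ∣ ≤? 1
... | yes ∣S∩T∣≤1 = ≤-trans ∣S∩T∣≤1 (s≤s z≤n)
... | no  ∣S∩T∣≰1
  with S′ , S′-geodetic , ∣S′∣≤∣S─T∣+4 ← replaceTwinsByFour G twins ¬simplicial (≰⇒> ∣S∩T∣≰1) geodetic =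
  +-cancelˡ-≤ ∣ S ─ T ∣ ∣ S ∩ T ∣ 4 (begin
    ∣ S ─ T ∣ + ∣ S ∩ T ∣ ≡⟨ sym (∣p∣≡∣p─q∣+∣p∩q∣ S T) ⟩
    ∣ S ∣                 ≤⟨ minimum S′ S′-geodetic ⟩
    ∣ S′ ∣                ≤⟨ ∣S′∣≤∣S─T∣+4 ⟩
    ∣ S ─ T ∣ + 4         ∎)
  where open ≤-Reasoning
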